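{- Let $r\ge4$, let $[3]=\{1,2,3\}$ be the ground set of $U_{2,3}$ and $E=A\cup B\cup C\cup D$ the ground set of $M(r)$. Let $P$ be any quasi product of $U_{2,3}$ and $M(r)$. Then at least one of the sets $$X=([3]\times A)\cup(\{1\}\times B)\cup(\{2\}\times C)\cup(\{3\}\times D),\qquad Y=([3]\times B)\cup(\{1\}\times A)\cup(\{2\}\times C)\cup(\{3\}\times D)$$ is a spanning set of $P$.
   Context: For $r\ge4$, let $A=\{a_1,\dots,a_{r-2}\}$, $B$, $C$, $D$ be pairwise disjoint sets of size $r-2$. $M(r)$ (Lindström's matroid; $M(4)$ is the Vámos matroid) is the rank-$r$ matroid on $E=A\cup B\cup C\cup D$ whose nonempty proper cyclic flats (flats that are unions of circuits) are exactly $A\cup B, A\cup C, A\cup D, B\cup C, B\cup D$, each of rank $r-1$. For matroids $M,N$, a matroid $P$ on $E(M)\times E(N)$ is a quasi product of $M$ and $N$ if: for every non-loop $e\in E(M)$, $x\mapsto(e,x)$ is an isomorphism $N\cong P|_{\{e\}\times E(N)}$; for every non-loop $f\in E(N)$, $x\mapsto(x,f)$ is an isomorphism $M\cong P|_{E(M)\times\{f\}}$; for loops $e$ of $M$ (resp. $f$ of $N$), $P|_{\{e\}\times E(N)}$ (resp. $P|_{E(M)\times\{f\}}$) has rank $0$. -}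

module Defs where

open import Data.Bool using (Bool; true; false; T; _∧_; _∨_)
open import Data.Nat using (ℕ; zero; suc; _+_; _*_; _∸_; _≤_; _<_; _≤ᵇ_; _⊓_)
open import Data.Nat.Properties using (≤ᵇ⇒≤; ⊓-monoʳ-≤)
open import Data.Fin using (Fin; remQuot; _≟_)
import Data.Fin as Fin
open import Data.Fin.Subset using (Subset; ⊤; ⊥; ⁅_⁆; _∈_; _∉_; _⊆_; _⊂_; _∪_; _∩_; ∣_∣)
open import Data.Fin.Subset.Properties using (p⊆q⇒∣p∣≤∣q∣)
open import Data.Vec using (Vec; []; _∷_; tabulate; lookup)
open import Data.Product using (_×_; _,_; proj₁; proj₂; ∃-syntax)
open import Data.Sum using (_⊎_)
open import Relation.Nullary using (¬_; ⌊_⌋)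
open import Relation.Binary.PropositionalEquality using (_≡_; _≢_)

record Matroid (n : ℕ) : Set where
  field
    rank      : Subset n → ℕ
    rank-card : ∀ X → rank X ≤ ∣ X ∣
    rank-mono : ∀ X Y → X ⊆ Y → rank X ≤ rank Y
    rank-sub  : ∀ X Y → rank (X ∪ Y) + rank (X ∩ Y) ≤ rank X + rank Y
open Matroid public

module _ {n : ℕ} (M : Matroid n) where

  matroidRank : ℕ
  matroidRank = rank M ⊤

  Independent : Subset n → Set
  Independent X = rank M X ≡ ∣ X ∣

  IsCircuit : Subset n → Set
  IsCircuit C = ¬ Independent C × (∀ Y → Y ⊂ C → Independent Y)

  IsFlat : Subset n → Set
  IsFlat F = ∀ e → e ∉ F → rank M F < rank M (F ∪ ⁅ e ⁆)

  IsCyclic : Subset n → Set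
  IsCyclic F = ∀ e → e ∈ F → ∃[ C ] (IsCircuit C × e ∈ C × C ⊆ F)

  IsCyclicFlat : Subset n → Set
  IsCyclicFlat F = IsFlat F × IsCyclic F

  IsLoop : Fin n → Set
  IsLoop e = rank M ⁅ e ⁆ ≡ 0

  Spanning : Subset n → Set
  Spanning X = rank M X ≡ rank M ⊤

private
  le : ∀ {x y} {t : T (x ≤ᵇ y)} → x ≤ y
  le {x} {y} {t} = ≤ᵇ⇒≤ x y t

  u23r : Subset 3 → ℕ
  u23r X = 2 ⊓ ∣ X ∣

  u23-R3 : ∀ a b c d e f →
    u23r ((a ∷ b ∷ c ∷ []) ∪ (d ∷ e ∷ f ∷ [])) + u23r ((a ∷ b ∷ c ∷ []) ∩ (d ∷ e ∷ f ∷ []))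
      ≤ u23r (a ∷ b ∷ c ∷ []) + u23r (d ∷ e ∷ f ∷ [])
  u23-R3 false false false false false false = le
  u23-R3 false false false false false true = le
  u23-R3 false false false false true false = le
  u23-R3 false false false false true true = le
  u23-R3 false false false true false false = le
  u23-R3 false false false true false true = le
  u23-R3 false false false true true false = le
  u23-R3 false false false true true true = le
  u23-R3 false false true false false false = le
  u23-R3 false false true false false true = le
  u23-R3 false false true false true false = le
  u23-R3 false false true false true true = le
  u23-R3 false false true true false false = le
  u23-R3 false false true true false true = le
  u23-R3 false false true true true false = le
  u23-R3 false false true true true true = le
  u23-R3 false true false false false false = le
  u23-R3 false true false false false true = le
  u23-R3 false true false false true false = le
  u23-R3 false true false false true true = le
  u23-R3 false true false true false false = le
  u23-R3 false true false true false true = le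
  u23-R3 false true false true true false = le
  u23-R3 false true false true true true = le
  u23-R3 false true true false false false = le
  u23-R3 false true true false false true = le
  u23-R3 false true true false true false = le
  u23-R3 false true true false true true = le
  u23-R3 false true true true false false = le
  u23-R3 false true true true false true = le
  u23-R3 false true true true true false = le
  u23-R3 false true true true true true = le
  u23-R3 true false false false false false = le
  u23-R3 true false false false false true = le
  u23-R3 true false false false true false = le
  u23-R3 true false false false true true = le
  u23-R3 true false false true false false = le
  u23-R3 true false false true false true = le
  u23-R3 true false false true true false = le
  u23-R3 true false false true true true = le
  u23-R3 true false true false false false = le
  u23-R3 true false true false false true = le
  u23-R3 true false true false true false = le
  u23-R3 true false true false true true = le
  u23-R3 true false true true false false = le
  u23-R3 true false true true false true = le
  u23-R3 true false true true true false = le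
  u23-R3 true false true true true true = le
  u23-R3 true true false false false false = le
  u23-R3 true true false false false true = le
  u23-R3 true true false false true false = le
  u23-R3 true true false false true true = le
  u23-R3 true true false true false false = le
  u23-R3 true true false true false true = le
  u23-R3 true true false true true false = le
  u23-R3 true true false true true true = le
  u23-R3 true true true false false false = le
  u23-R3 true true true false false true = le
  u23-R3 true true true false true false = le
  u23-R3 true true true false true true = le
  u23-R3 true true true true false false = le
  u23-R3 true true true true false true = le
  u23-R3 true true true true true false = le
  u23-R3 true true true true true true = le
  u23-R1 : ∀ X → u23r X ≤ ∣ X ∣
  u23-R1 (a ∷ b ∷ c ∷ []) with a | b | c
  ... | false | false | false = le
  ... | false | false | true  = le
  ... | false | true  | false = le
  ... | false | true  | true  = le
  ... | true  | false | false = le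
  ... | true  | false | true  = le
  ... | true  | true  | false = le
  ... | true  | true  | true  = le

U23 : Matroid 3
U23 = record
  { rank      = λ X → 2 ⊓ ∣ X ∣
  ; rank-card = u23-R1
  ; rank-mono = λ X Y X⊆Y → ⊓-monoʳ-≤ 2 (p⊆q⇒∣p∣≤∣q∣ X⊆Y)
  ; rank-sub  = λ { (a ∷ b ∷ c ∷ []) (d ∷ e ∷ f ∷ []) → u23-R3 a b c d e f }
  }

-- Ground set of M(r): E = Fin (4 * m) with m = r - 2, split into four
-- blocks of size m via remQuot: block 0 = A, 1 = B, 2 = C, 3 = D.

block : {m : ℕ} → Fin (4 * m) → Fin 4
block {m} x = proj₁ (remQuot {4} m x)

blockSet : (m : ℕ) → Fin 4 → Subset (4 * m)
blockSet m i = tabulate (λ x → ⌊ block {m} x ≟ i ⌋)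

setA setB setC setD : (m : ℕ) → Subset (4 * m)
setA m = blockSet m Fin.zero
setB m = blockSet m (Fin.suc Fin.zero)
setC m = blockSet m (Fin.suc (Fin.suc Fin.zero))
setD m = blockSet m (Fin.suc (Fin.suc (Fin.suc Fin.zero)))

-- N is (a copy of) Lindström's matroid M(r), r = m + 2 ≥ 4:
-- rank r, nonempty proper cyclic flats exactly A∪B, A∪C, A∪D, B∪C, B∪D,
-- each of rank r - 1.
IsLindstrom : (r : ℕ) → Matroid (4 * (r ∸ 2)) → Set
IsLindstrom r N =
  matroidRank N ≡ r
  × (∀ F → (IsCyclicFlat N F × F ≢ ⊥ × F ≢ ⊤) →
        (F ≡ A ∪ B ⊎ F ≡ A ∪ C ⊎ F ≡ A ∪ D ⊎ F ≡ B ∪ C ⊎ F ≡ B ∪ D))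
  × (∀ F → (F ≡ A ∪ B ⊎ F ≡ A ∪ C ⊎ F ≡ A ∪ D ⊎ F ≡ B ∪ C ⊎ F ≡ B ∪ D) →
        (IsCyclicFlat N F × F ≢ ⊥ × F ≢ ⊤))
  × rank N (A ∪ B) ≡ r ∸ 1 × rank N (A ∪ C) ≡ r ∸ 1 × rank N (A ∪ D) ≡ r ∸ 1
  × rank N (B ∪ C) ≡ r ∸ 1 × rank N (B ∪ D) ≡ r ∸ 1
  where
  A = setA (r ∸ 2)
  B = setB (r ∸ 2)
  C = setC (r ∸ 2)
  D = setD (r ∸ 2)

-- Product ground set E(M) × E(N) encoded as Fin (k * n) via remQuot / combine.

pairOf : {k n : ℕ} → Fin (k * n) → Fin k × Fin n
pairOf {k} {n} p = remQuot {k} n p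

rowSet : {k n : ℕ} → Fin k → Subset n → Subset (k * n)
rowSet {k} {n} e X = tabulate (λ p → ⌊ proj₁ (pairOf {k} {n} p) ≟ e ⌋ ∧ lookup X (proj₂ (pairOf {k} {n} p)))

colSet : {k n : ℕ} → Subset k → Fin n → Subset (k * n)
colSet {k} {n} X f = tabulate (λ p → lookup X (proj₁ (pairOf {k} {n} p)) ∧ ⌊ proj₂ (pairOf {k} {n} p) ≟ f ⌋)

-- Quasi product. Since x ↦ (e,x) is a bijection E(N) → {e} × E(N), it is an
-- isomorphism N ≅ P|({e}×E(N)) iff it preserves ranks of all subsets.
IsQuasiProduct : {k n : ℕ} → Matroid k → Matroid n → Matroid (k * n) → Set
IsQuasiProduct {k} {n} M N P =
    (∀ e → ¬ IsLoop M e → ∀ X → rank P (rowSet {k} {n} e X) ≡ rank N X)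
  × (∀ f → ¬ IsLoop N f → ∀ X → rank P (colSet {k} {n} X f) ≡ rank M X)
  × (∀ e → IsLoop M e → rank P (rowSet {k} {n} e ⊤) ≡ 0)
  × (∀ f → IsLoop N f → rank P (colSet {k} {n} ⊤ f) ≡ 0)

-- The sets X and Y of the theorem (with [3] = {0,1,2} = Fin 3, so 1,2,3 ↦ 0,1,2).

setX setY : (m : ℕ) → Subset (3 * (4 * m))
setX m = tabulate λ p → let i = proj₁ (pairOf {3} {4 * m} p) ; b = block {m} (proj₂ (pairOf {3} {4 * m} p)) in
  ⌊ b ≟ Fin.zero ⌋
  ∨ (⌊ i ≟ Fin.zero ⌋ ∧ ⌊ b ≟ Fin.suc Fin.zero ⌋)
  ∨ (⌊ i ≟ Fin.suc Fin.zero ⌋ ∧ ⌊ b ≟ Fin.suc (Fin.suc Fin.zero) ⌋)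
  ∨ (⌊ i ≟ Fin.suc (Fin.suc Fin.zero) ⌋ ∧ ⌊ b ≟ Fin.suc (Fin.suc (Fin.suc Fin.zero)) ⌋)
setY m = tabulate λ p → let i = proj₁ (pairOf {3} {4 * m} p) ; b = block {m} (proj₂ (pairOf {3} {4 * m} p)) in
  ⌊ b ≟ Fin.suc Fin.zero ⌋
  ∨ (⌊ i ≟ Fin.zero ⌋ ∧ ⌊ b ≟ Fin.zero ⌋)
  ∨ (⌊ i ≟ Fin.suc Fin.zero ⌋ ∧ ⌊ b ≟ Fin.suc (Fin.suc Fin.zero) ⌋)
  ∨ (⌊ i ≟ Fin.suc (Fin.suc Fin.zero) ⌋ ∧ ⌊ b ≟ Fin.suc (Fin.suc (Fin.suc Fin.zero)) ⌋)

-- By submodularity r X + r Y ≥ r (X ∪ Y) + r (X ∩ Y), so it suffices that X ∪ Y spans P and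
-- r (X ∩ Y) ≥ r P - 1. In P, rows are copies of M(r) and columns copies of U_{2,3}.
-- Rows 2 and 3 of X ∪ Y contain A ∪ B ∪ C and A ∪ B ∪ D, which span M(r) because the flat A ∪ B
-- has rank r - 1; so those rows lie in the closure of X ∪ Y, and then every column does, since
-- two points span U_{2,3}. Next, X ∩ Y = ({1} × (A ∪ B)) ∪ ({2} × C) ∪ ({3} × D); adding the row
-- R = {1} × E, the columns through C bring in {3} × C, and C ∪ D spans M(r): otherwise, having
-- 2r - 4 > r - 1 elements, it contains a circuit whose closure is a nonempty proper cyclic flat
-- of rank r - 1 ≥ r (C ∪ D), hence contains C ∪ D, which none of the five cyclic flats does.
-- So (X ∩ Y) ∪ R spans P, while (X ∩ Y) ∩ R ⊇ {1} × (A ∪ B) has rank r - 1 and R has rank r;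
-- submodularity once more gives r (X ∩ Y) ≥ r P - 1.

module Submission where

open import Defs
open import Data.Bool using (Bool; true; false; T; _∧_; _∨_)
open import Data.Bool.Properties using (T-≡; T-∧)
open import Data.Empty using (⊥-elim)
open import Data.Fin using (Fin; zero; suc; #_; _≟_; _↑ˡ_; _↑ʳ_; quotient; combine)
open import Data.Fin.Properties using (any?; splitAt-↑ˡ; splitAt-↑ʳ; remQuot-combine)
open import Data.Fin.Subset
open import Data.Fin.Subset.Properties
open import Data.List using (filter; allFin) renaming ([] to []ₗ; _∷_ to _∷ₗ_)
open import Data.List.Membership.Propositional using () renaming (_∈_ to _∈ₗ_)
open import Data.List.Membership.Propositional.Properties using (∈-allFin; ∈-filter⁺; ∈-filter⁻)
open import Data.List.Relation.Unary.Any using () renaming (here to hereₗ; there to thereₗ)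
open import Data.Nat as ℕ using (ℕ; zero; suc; _≤_; _<_; _+_; _*_; _∸_; z≤n; s≤s; s≤s⁻¹; _≤?_)
open import Data.Nat.Induction using (<-wellFounded)
open import Data.Nat.Properties hiding (_≟_)
open import Data.Product using (_×_; _,_; proj₁; proj₂; ∃-syntax)
open import Data.Sum using (_⊎_; inj₁; inj₂; [_,_]′)
open import Data.Vec using ([]; _∷_; here; tabulate; lookup; replicate)
open import Data.Vec.Properties using (lookup∘tabulate; []=⇒lookup; lookup⇒[]=; tabulate-cong)
open import Function using (_∘_; id)
open import Function.Bundles using (Equivalence)
open import Induction.WellFounded using (Acc; acc)
open import Relation.Nullary using (¬_; yes; no; ⌊_⌋; ¬?)
open import Relation.Nullary.Decidable using (toWitness; fromWitness; decidable-stable; _×-dec_)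
open import Relation.Binary.PropositionalEquality

open Equivalence using (to; from)

private
  variable
    n : ℕ
    p q s : Subset n
    x : Fin n

∈-tabulate⁺ : {g : Fin n → Bool} → T (g x) → x ∈ tabulate g
∈-tabulate⁺ {x = x} {g} t = lookup⇒[]= x (tabulate g) (trans (lookup∘tabulate g x) (to T-≡ t))

∈-tabulate⁻ : {g : Fin n → Bool} → x ∈ tabulate g → T (g x)
∈-tabulate⁻ {x = x} {g} x∈ = from T-≡ (trans (sym (lookup∘tabulate g x)) ([]=⇒lookup x∈))

T-lookup⇒∈ : T (lookup p x) → x ∈ p
T-lookup⇒∈ {p = p} {x} t = lookup⇒[]= x p (to T-≡ t)

∈⇒T-lookup : x ∈ p → T (lookup p x)
∈⇒T-lookup x∈ = from T-≡ ([]=⇒lookup x∈)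

∪-⊆ : p ⊆ s → q ⊆ s → p ∪ q ⊆ s
∪-⊆ {p = p} {q = q} p⊆s q⊆s x∈ = [ p⊆s , q⊆s ]′ (x∈p∪q⁻ p q x∈)

x∈p⇒⁅x⁆⊆p : x ∈ p → ⁅ x ⁆ ⊆ p
x∈p⇒⁅x⁆⊆p {x = x} {p = p} x∈p y∈ = subst (_∈ p) (sym (x∈⁅y⁆⇒x≡y x y∈)) x∈p

∣p∣+∣q─p∣≡∣q∣ : p ⊆ q → ∣ p ∣ + ∣ q ─ p ∣ ≡ ∣ q ∣
∣p∣+∣q─p∣≡∣q∣ {p = []} {[]} _ = refl
∣p∣+∣q─p∣≡∣q∣ {p = true ∷ p} {true ∷ q} p⊆q = cong suc (∣p∣+∣q─p∣≡∣q∣ (drop-∷-⊆ p⊆q))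
∣p∣+∣q─p∣≡∣q∣ {p = true ∷ p} {false ∷ q} p⊆q with () ← p⊆q here
∣p∣+∣q─p∣≡∣q∣ {p = false ∷ p} {true ∷ q} p⊆q =
  trans (+-suc ∣ p ∣ ∣ q ─ p ∣) (cong suc (∣p∣+∣q─p∣≡∣q∣ (drop-∷-⊆ p⊆q)))
∣p∣+∣q─p∣≡∣q∣ {p = false ∷ p} {false ∷ q} p⊆q = ∣p∣+∣q─p∣≡∣q∣ (drop-∷-⊆ p⊆q)

∣p∣≡1+∣p-x∣ : x ∈ p → ∣ p ∣ ≡ suc ∣ p - x ∣
∣p∣≡1+∣p-x∣ {x = x} {p = p} x∈p =
  trans (sym (∣p∣+∣q─p∣≡∣q∣ (x∈p⇒⁅x⁆⊆p x∈p))) (cong (_+ ∣ p - x ∣) (∣⁅x⁆∣≡1 x))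

tabulate-const : ∀ m (b : Bool) → tabulate {n = m} (λ _ → b) ≡ replicate m b
tabulate-const zero    b = refl
tabulate-const (suc m) b = cong (b ∷_) (tabulate-const m b)

∣tabulate∣-+ : ∀ a {b} (g : Fin (a + b) → Bool) →
  ∣ tabulate g ∣ ≡ ∣ tabulate (g ∘ (_↑ˡ b)) ∣ + ∣ tabulate (g ∘ (a ↑ʳ_)) ∣
∣tabulate∣-+ zero    g = refl
∣tabulate∣-+ (suc a) g with g zero
... | true  = cong suc (∣tabulate∣-+ a (g ∘ suc))
... | false = ∣tabulate∣-+ a (g ∘ suc)

quotient-↑ˡ : ∀ {k} m (i : Fin m) → quotient {suc k} m (i ↑ˡ k * m) ≡ zero
quotient-↑ˡ {k} m i rewrite splitAt-↑ˡ m i (k * m) = refl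

quotient-↑ʳ : ∀ {k} m (j : Fin (k * m)) → quotient {suc k} m (m ↑ʳ j) ≡ suc (quotient {k} m j)
quotient-↑ʳ {k} m j rewrite splitAt-↑ʳ m (k * m) j = refl

∣quotient⁻¹∣ : ∀ {k} m (s : Subset k) → ∣ tabulate (lookup s ∘ quotient m) ∣ ≡ ∣ s ∣ * m
∣quotient⁻¹∣ m [] = refl
∣quotient⁻¹∣ {suc k} m (b ∷ s) = begin
  ∣ tabulate (lookup (b ∷ s) ∘ quotient m) ∣
    ≡⟨ ∣tabulate∣-+ m _ ⟩
  ∣ tabulate (lookup (b ∷ s) ∘ quotient m ∘ (_↑ˡ k * m)) ∣ + ∣ tabulate (lookup (b ∷ s) ∘ quotient m ∘ (m ↑ʳ_)) ∣
    ≡⟨ cong₂ (λ u v → ∣ u ∣ + ∣ v ∣) (tabulate-cong (cong (lookup (b ∷ s)) ∘ quotient-↑ˡ m))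
                                    (tabulate-cong (cong (lookup (b ∷ s)) ∘ quotient-↑ʳ m)) ⟩
  ∣ tabulate {n = m} (λ _ → b) ∣ + ∣ tabulate (lookup s ∘ quotient m) ∣
    ≡⟨ cong₂ _+_ (cong ∣_∣ (tabulate-const m b)) (∣quotient⁻¹∣ m s) ⟩
  ∣ replicate m b ∣ + ∣ s ∣ * m
    ≡⟨ first-block b ⟩
  ∣ b ∷ s ∣ * m ∎
  where
  open ≡-Reasoning
  first-block : ∀ b → ∣ replicate m b ∣ + ∣ s ∣ * m ≡ ∣ b ∷ s ∣ * m
  first-block true  = cong (_+ ∣ s ∣ * m) (∣⊤∣≡n m)
  first-block false = cong (_+ ∣ s ∣ * m) (∣⊥∣≡0 m)

module MatroidProperties {n : ℕ} (M : Matroid n) where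

  private
    r : Subset n → ℕ
    r = rank M

  rank-⊆ : {X Y : Subset n} → X ⊆ Y → r X ≤ r Y
  rank-⊆ {X} {Y} = rank-mono M X Y

  rank-∪-≤ : ∀ X Y → r (X ∪ Y) ≤ r X + r Y
  rank-∪-≤ X Y = m+n≤o⇒m≤o (r (X ∪ Y)) (rank-sub M X Y)

  independent-⊆ : ∀ {Y Z} → Y ⊆ Z → Independent M Z → Independent M Y
  independent-⊆ {Y} {Z} Y⊆Z rZ≡∣Z∣ = ≤-antisym (rank-card M Y) (+-cancelʳ-≤ ∣ Z ─ Y ∣ ∣ Y ∣ (r Y) (begin
    ∣ Y ∣ + ∣ Z ─ Y ∣   ≡⟨ ∣p∣+∣q─p∣≡∣q∣ Y⊆Z ⟩
    ∣ Z ∣               ≡⟨ rZ≡∣Z∣ ⟨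
    r Z                 ≤⟨ rank-⊆ Z⊆Y∪Z─Y ⟩
    r (Y ∪ (Z ─ Y))     ≤⟨ rank-∪-≤ Y (Z ─ Y) ⟩
    r Y + r (Z ─ Y)     ≤⟨ +-monoʳ-≤ (r Y) (rank-card M (Z ─ Y)) ⟩
    r Y + ∣ Z ─ Y ∣     ∎))
    where
    open ≤-Reasoning
    Z⊆Y∪Z─Y : Z ⊆ Y ∪ (Z ─ Y)
    Z⊆Y∪Z─Y {x} x∈Z with x ∈? Y
    ... | yes x∈Y = x∈p∪q⁺ (inj₁ x∈Y)
    ... | no  x∉Y = x∈p∪q⁺ (inj₂ (x∈p∧x∉q⇒x∈p─q x∈Z x∉Y))

  dependent⇒nonempty : ∀ {Z} → ¬ Independent M Z → ∃[ z ] z ∈ Z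
  dependent⇒nonempty {Z} dep with any? (_∈? Z)
  ... | yes z∈Z = z∈Z
  ... | no  Z≡∅ = ⊥-elim (dep (trans (n≤0⇒n≡0 (subst (r Z ≤_) ∣Z∣≡0 (rank-card M Z))) (sym ∣Z∣≡0)))
    where
    ∣Z∣≡0 : ∣ Z ∣ ≡ 0
    ∣Z∣≡0 = n≤0⇒n≡0 (subst (∣ Z ∣ ≤_) (∣⊥∣≡0 n) (p⊆q⇒∣p∣≤∣q∣ {q = ⊥} (λ {x} x∈Z → ⊥-elim (Z≡∅ (x , x∈Z)))))

  dependent⇒∃circuit : ∀ D → ¬ Independent M D → ∃[ C ] (IsCircuit M C × C ⊆ D)
  dependent⇒∃circuit D = go D (<-wellFounded ∣ D ∣)
    where
    go : ∀ D → Acc _<_ ∣ D ∣ → ¬ Independent M D → ∃[ C ] (IsCircuit M C × C ⊆ D)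
    go D (acc smaller) dep with any? (λ x → x ∈? D ×-dec ¬? (r (D - x) ℕ.≟ ∣ D - x ∣))
    ... | yes (x , x∈D , dep-x) with go (D - x) (smaller (x∈p⇒∣p-x∣<∣p∣ x∈D)) dep-x
    ...   | C , isCircuit , C⊆D-x = C , isCircuit , p─q⊆p D ⁅ x ⁆ ∘ C⊆D-x
    go D _ dep | no none = D , (dep , minimal) , id
      where
      minimal : ∀ Y → Y ⊂ D → Independent M Y
      minimal Y (Y⊆D , x , x∈D , x∉Y) =
        independent-⊆ (λ y∈Y → x∈p∧x≢y⇒x∈p-y (Y⊆D y∈Y) λ { refl → x∉Y y∈Y })
                      (decidable-stable (r (D - x) ℕ.≟ ∣ D - x ∣) (λ dep-x → none (x , x∈D , dep-x)))

  Absorbs : Subset n → Subset n → Set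
  Absorbs S Z = r (S ∪ Z) ≤ r S

  absorbs-⊇ : ∀ {W S Z} → W ⊆ S → Absorbs W Z → Absorbs S Z
  absorbs-⊇ {W} {S} {Z} W⊆S W-absorbs = +-cancelʳ-≤ (r W) (r (S ∪ Z)) (r S) (begin
    r (S ∪ Z) + r W                   ≤⟨ +-mono-≤ (rank-⊆ S∪Z⊆) (rank-⊆ W⊆) ⟩
    r ((W ∪ Z) ∪ S) + r ((W ∪ Z) ∩ S) ≤⟨ rank-sub M (W ∪ Z) S ⟩
    r (W ∪ Z) + r S                   ≤⟨ +-monoˡ-≤ (r S) W-absorbs ⟩
    r W + r S                         ≡⟨ +-comm (r W) (r S) ⟩
    r S + r W                         ∎)
    where
    open ≤-Reasoning
    S∪Z⊆ : S ∪ Z ⊆ (W ∪ Z) ∪ S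
    S∪Z⊆ = ∪-⊆ (q⊆p∪q (W ∪ Z) S) (⊆-trans (q⊆p∪q W Z) (p⊆p∪q S))
    W⊆ : W ⊆ (W ∪ Z) ∩ S
    W⊆ w∈W = x∈p∩q⁺ (p⊆p∪q Z w∈W , W⊆S w∈W)

  absorbs-pointwise : ∀ {S Z} → (∀ x → x ∈ Z → Absorbs S ⁅ x ⁆) → Absorbs S Z
  absorbs-pointwise {S} {Z} each = go (filter (_∈? Z) (allFin n)) S
    (λ x x∈L → each x (proj₂ (∈-filter⁻ (_∈? Z) {xs = allFin n} x∈L)))
    (λ {y} y∈Z → inj₂ (∈-filter⁺ (_∈? Z) (∈-allFin y) y∈Z))
    where
    go : ∀ L S → (∀ x → x ∈ₗ L → Absorbs S ⁅ x ⁆) → (∀ {y} → y ∈ Z → y ∈ S ⊎ y ∈ₗ L) → Absorbs S Z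
    go []ₗ      S _    covered = rank-⊆ (∪-⊆ id (λ y∈Z → [ id , (λ ()) ]′ (covered y∈Z)))
    go (x ∷ₗ L) S each covered = begin
      r (S ∪ Z)           ≤⟨ rank-⊆ (∪-⊆ (⊆-trans (p⊆p∪q ⁅ x ⁆) (p⊆p∪q Z)) (q⊆p∪q (S ∪ ⁅ x ⁆) Z)) ⟩
      r ((S ∪ ⁅ x ⁆) ∪ Z) ≤⟨ go L (S ∪ ⁅ x ⁆) (λ y y∈L → absorbs-⊇ (p⊆p∪q ⁅ x ⁆) (each y (thereₗ y∈L))) covered′ ⟩
      r (S ∪ ⁅ x ⁆)       ≤⟨ each x (hereₗ refl) ⟩
      r S                 ∎
      where
      open ≤-Reasoning
      covered′ : ∀ {y} → y ∈ Z → y ∈ S ∪ ⁅ x ⁆ ⊎ y ∈ₗ L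
      covered′ {y} y∈Z with covered y∈Z
      ... | inj₁ y∈S            = inj₁ (p⊆p∪q ⁅ x ⁆ y∈S)
      ... | inj₂ (hereₗ refl)   = inj₁ (q⊆p∪q S ⁅ x ⁆ (x∈⁅x⁆ x))
      ... | inj₂ (thereₗ y∈L)   = inj₂ y∈L

  cl : Subset n → Subset n
  cl S = tabulate (λ x → ⌊ r (S ∪ ⁅ x ⁆) ≤? r S ⌋)

  ∈cl⁺ : ∀ {S x} → Absorbs S ⁅ x ⁆ → x ∈ cl S
  ∈cl⁺ = ∈-tabulate⁺ ∘ fromWitness

  ∈cl⁻ : ∀ {S x} → x ∈ cl S → Absorbs S ⁅ x ⁆
  ∈cl⁻ = toWitness ∘ ∈-tabulate⁻

  ⊆cl : ∀ {S} → S ⊆ cl S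
  ⊆cl x∈S = ∈cl⁺ (rank-⊆ (∪-⊆ id (x∈p⇒⁅x⁆⊆p x∈S)))

  rank-cl : ∀ S → r (cl S) ≤ r S
  rank-cl S = ≤-trans (rank-⊆ (q⊆p∪q S (cl S))) (absorbs-pointwise (λ _ → ∈cl⁻))

  cl-⊆ : ∀ {S T} → S ⊆ cl T → cl S ⊆ cl T
  cl-⊆ {S} {T} S⊆clT {x} x∈clS = ∈cl⁺ (begin
    r (T ∪ ⁅ x ⁆)    ≤⟨ rank-⊆ (∪-⊆ (⊆-trans ⊆cl (p⊆p∪q ⁅ x ⁆)) (q⊆p∪q (cl T) ⁅ x ⁆)) ⟩
    r (cl T ∪ ⁅ x ⁆) ≤⟨ absorbs-⊇ S⊆clT (∈cl⁻ x∈clS) ⟩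
    r (cl T)         ≤⟨ rank-cl T ⟩
    r T              ∎)
    where open ≤-Reasoning

  ⊆cl-by-rank : ∀ {W L} → W ⊆ L → r L ≤ r W → L ⊆ cl W
  ⊆cl-by-rank W⊆L rL≤rW x∈L = ∈cl⁺ (≤-trans (rank-⊆ (∪-⊆ W⊆L (x∈p⇒⁅x⁆⊆p x∈L))) rL≤rW)

  cl-isFlat : ∀ S → IsFlat M (cl S)
  cl-isFlat S x x∉clS = begin-strict
    r (cl S)         ≤⟨ rank-cl S ⟩
    r S              <⟨ ≰⇒> (x∉clS ∘ ∈cl⁺) ⟩
    r (S ∪ ⁅ x ⁆)    ≤⟨ rank-⊆ (∪-⊆ (⊆-trans ⊆cl (p⊆p∪q ⁅ x ⁆)) (q⊆p∪q (cl S) ⁅ x ⁆)) ⟩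
    r (cl S ∪ ⁅ x ⁆) ∎
    where open ≤-Reasoning

  flat-absorbs⇒⊇ : ∀ {F G} → IsFlat M F → Absorbs F G → G ⊆ F
  flat-absorbs⇒⊇ {F} {G} F-flat F-absorbs {x} x∈G = decidable-stable (x ∈? F) λ x∉F →
    <⇒≱ (F-flat x x∉F) (≤-trans (rank-⊆ (∪-⊆ (p⊆p∪q G) (⊆-trans (x∈p⇒⁅x⁆⊆p x∈G) (q⊆p∪q F G)))) F-absorbs)

  exchange-dependent : ∀ {Z z e} → ¬ Independent M Z → z ∈ Z → e ∈ cl Z → e ∉ Z →
                       ¬ Independent M ((Z - z) ∪ ⁅ e ⁆)
  exchange-dependent {Z} {z} {e} dep z∈Z e∈clZ e∉Z = <⇒≢ (begin-strict
    r ((Z - z) ∪ ⁅ e ⁆) ≤⟨ rank-⊆ (∪-⊆ (⊆-trans (p─q⊆p Z ⁅ z ⁆) (p⊆p∪q ⁅ e ⁆)) (q⊆p∪q Z ⁅ e ⁆)) ⟩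
    r (Z ∪ ⁅ e ⁆)       ≤⟨ ∈cl⁻ e∈clZ ⟩
    r Z                 <⟨ ≤∧≢⇒< (rank-card M Z) dep ⟩
    ∣ Z ∣               ≡⟨ ∣p∣≡1+∣p-x∣ z∈Z ⟩
    suc ∣ Z - z ∣       ≤⟨ p⊂q⇒∣p∣<∣q∣ Z-z⊂ ⟩
    ∣ (Z - z) ∪ ⁅ e ⁆ ∣ ∎)
    where
    open ≤-Reasoning
    Z-z⊂ : Z - z ⊂ (Z - z) ∪ ⁅ e ⁆
    Z-z⊂ = p⊆p∪q ⁅ e ⁆ , e , q⊆p∪q (Z - z) ⁅ e ⁆ (x∈⁅x⁆ e) , e∉Z ∘ p─q⊆p Z ⁅ z ⁆

  cl-circuit-isCyclic : ∀ {Z} → IsCircuit M Z → IsCyclic M (cl Z)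
  cl-circuit-isCyclic {Z} Z-circuit@(dep , minimal) e e∈clZ with e ∈? Z | dependent⇒nonempty dep
  ... | yes e∈Z | _ = Z , Z-circuit , e∈Z , ⊆cl
  ... | no e∉Z | z , z∈Z with dependent⇒∃circuit _ (exchange-dependent dep z∈Z e∈clZ e∉Z)
  ...   | C , C-circuit , C⊆W = C , C-circuit , e∈C , C⊆clZ
    where
    e∈C : e ∈ C
    e∈C = decidable-stable (e ∈? C) λ e∉C →
      proj₁ C-circuit (independent-⊆ (C⊆Z-z e∉C) (minimal (Z - z) (x∈p⇒p-x⊂p z∈Z)))
      where
      C⊆Z-z : e ∉ C → C ⊆ Z - z
      C⊆Z-z e∉C {y} y∈C with x∈p∪q⁻ (Z - z) ⁅ e ⁆ (C⊆W y∈C)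
      ... | inj₁ y∈Z-z = y∈Z-z
      ... | inj₂ y∈⁅e⁆ = ⊥-elim (e∉C (subst (_∈ C) (x∈⁅y⁆⇒x≡y e y∈⁅e⁆) y∈C))
    C⊆clZ : C ⊆ cl Z
    C⊆clZ {y} y∈C with x∈p∪q⁻ (Z - z) ⁅ e ⁆ (C⊆W y∈C)
    ... | inj₁ y∈Z-z = ⊆cl (p─q⊆p Z ⁅ z ⁆ y∈Z-z)
    ... | inj₂ y∈⁅e⁆ = subst (_∈ cl Z) (sym (x∈⁅y⁆⇒x≡y e y∈⁅e⁆)) e∈clZ

  rank⊤≤⇒spanning : ∀ {X} → r ⊤ ≤ r X → Spanning M X
  rank⊤≤⇒spanning = ≤-antisym (rank-⊆ ⊆⊤)

  cl≡⊤⇒spanning : ∀ {S} → (∀ x → x ∈ cl S) → Spanning M S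
  cl≡⊤⇒spanning {S} everywhere = rank⊤≤⇒spanning (≤-trans (rank-⊆ (λ {x} _ → everywhere x)) (rank-cl S))

  spanning-∪⇒submodular : ∀ {X Y} → Spanning M (X ∪ Y) → r ⊤ + r (X ∩ Y) ≤ r X + r Y
  spanning-∪⇒submodular {X} {Y} X∪Y-spanning =
    subst (λ t → t + r (X ∩ Y) ≤ r X + r Y) X∪Y-spanning (rank-sub M X Y)

  -- r X + r Y ≥ 2 r ⊤ - 1 leaves no room for both X and Y to have corank ≥ 1.
  spanning-∪⇒spanning-⊎ : ∀ {X Y} → Spanning M (X ∪ Y) → r ⊤ ≤ suc (r (X ∩ Y)) →
                          Spanning M X ⊎ Spanning M Y
  spanning-∪⇒spanning-⊎ {X} {Y} X∪Y-spanning r⊤≤ with r X ℕ.≟ r ⊤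
  ... | yes X-spanning = inj₁ X-spanning
  ... | no  rX≢r⊤      = inj₂ (rank⊤≤⇒spanning (+-cancelˡ-≤ (r ⊤) (r ⊤) (r Y) (begin
    r ⊤ + r ⊤               ≤⟨ +-monoʳ-≤ (r ⊤) r⊤≤ ⟩
    r ⊤ + suc (r (X ∩ Y))   ≡⟨ +-suc (r ⊤) (r (X ∩ Y)) ⟩
    suc (r ⊤ + r (X ∩ Y))   ≤⟨ s≤s (spanning-∪⇒submodular X∪Y-spanning) ⟩
    suc (r X) + r Y         ≤⟨ +-monoˡ-≤ (r Y) (≤∧≢⇒< (rank-⊆ ⊆⊤) rX≢r⊤) ⟩
    r ⊤ + r Y               ∎)))
    where open ≤-Reasoning

∈blockSet⁺ : ∀ {m} {x : Fin (4 * m)} {i} → block {m} x ≡ i → x ∈ blockSet m i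
∈blockSet⁺ = ∈-tabulate⁺ ∘ fromWitness

∈blockSet⁻ : ∀ {m} {x : Fin (4 * m)} {i} → x ∈ blockSet m i → block {m} x ≡ i
∈blockSet⁻ = toWitness ∘ ∈-tabulate⁻

combine∈blockSet : ∀ {m} i (j : Fin m) → combine i j ∈ blockSet m i
combine∈blockSet {m} i j = ∈blockSet⁺ {m} (cong proj₁ (remQuot-combine i j))

∉blockSet-∪ : ∀ {m} {x : Fin (4 * m)} {b i j} → x ∈ blockSet m b → b ≢ i → b ≢ j →
              x ∉ blockSet m i ∪ blockSet m j
∉blockSet-∪ {m} {x} {b} {i} {j} x∈b b≢i b≢j x∈ with x∈p∪q⁻ (blockSet m i) (blockSet m j) x∈
... | inj₁ x∈i = b≢i (trans (sym (∈blockSet⁻ {m} x∈b)) (∈blockSet⁻ {m} x∈i))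
... | inj₂ x∈j = b≢j (trans (sym (∈blockSet⁻ {m} x∈b)) (∈blockSet⁻ {m} x∈j))

module Lindström (k : ℕ) (N : Matroid (4 * (2 + k))) where

  open MatroidProperties N

  private
    m : ℕ
    m = 2 + k

  A B C D : Subset (4 * m)
  A = setA m
  B = setB m
  C = setC m
  D = setD m

  IsCyclicHyperplane : Subset (4 * m) → Set
  IsCyclicHyperplane F = F ≡ A ∪ B ⊎ F ≡ A ∪ C ⊎ F ≡ A ∪ D ⊎ F ≡ B ∪ C ⊎ F ≡ B ∪ D

  c₀ d₀ : Fin (4 * m)
  c₀ = combine {4} {m} (# 2) zero
  d₀ = combine {4} {m} (# 3) zero

  c₀∈C : c₀ ∈ C
  c₀∈C = combine∈blockSet {m} (# 2) zero

  d₀∈D : d₀ ∈ D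
  d₀∈D = combine∈blockSet {m} (# 3) zero

  cyclicHyperplane-rank : IsLindstrom (4 + k) N → ∀ {F} → IsCyclicHyperplane F → rank N F ≡ 3 + k
  cyclicHyperplane-rank (_ , _ , _ , rAB , _   , _   , _   , _  ) (inj₁ refl)                      = rAB
  cyclicHyperplane-rank (_ , _ , _ , _   , rAC , _   , _   , _  ) (inj₂ (inj₁ refl))               = rAC
  cyclicHyperplane-rank (_ , _ , _ , _   , _   , rAD , _   , _  ) (inj₂ (inj₂ (inj₁ refl)))        = rAD
  cyclicHyperplane-rank (_ , _ , _ , _   , _   , _   , rBC , _  ) (inj₂ (inj₂ (inj₂ (inj₁ refl)))) = rBC
  cyclicHyperplane-rank (_ , _ , _ , _   , _   , _   , _   , rBD) (inj₂ (inj₂ (inj₂ (inj₂ refl)))) = rBD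

  C∪D⊈cyclicHyperplane : ¬ (∃[ F ] (IsCyclicHyperplane F × C ∪ D ⊆ F))
  C∪D⊈cyclicHyperplane (_ , inj₁ refl                      , C∪D⊆F) = ∉blockSet-∪ {m} c₀∈C (λ ()) (λ ()) (C∪D⊆F (p⊆p∪q D c₀∈C))
  C∪D⊈cyclicHyperplane (_ , inj₂ (inj₁ refl)               , C∪D⊆F) = ∉blockSet-∪ {m} d₀∈D (λ ()) (λ ()) (C∪D⊆F (q⊆p∪q C D d₀∈D))
  C∪D⊈cyclicHyperplane (_ , inj₂ (inj₂ (inj₁ refl))        , C∪D⊆F) = ∉blockSet-∪ {m} c₀∈C (λ ()) (λ ()) (C∪D⊆F (p⊆p∪q D c₀∈C))
  C∪D⊈cyclicHyperplane (_ , inj₂ (inj₂ (inj₂ (inj₁ refl))) , C∪D⊆F) = ∉blockSet-∪ {m} d₀∈D (λ ()) (λ ()) (C∪D⊆F (q⊆p∪q C D d₀∈D))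
  C∪D⊈cyclicHyperplane (_ , inj₂ (inj₂ (inj₂ (inj₂ refl))) , C∪D⊆F) = ∉blockSet-∪ {m} c₀∈C (λ ()) (λ ()) (C∪D⊆F (p⊆p∪q D c₀∈C))

  dependent⇒⊆cyclicHyperplane : IsLindstrom (4 + k) N → ∀ {S} → rank N S ≤ 3 + k → ¬ Independent N S →
                                ∃[ F ] (IsCyclicHyperplane F × S ⊆ F)
  dependent⇒⊆cyclicHyperplane L@(rank-N , cyclicFlat⇒hyperplane , _) {S} rS≤ dep
    with dependent⇒∃circuit S dep
  ... | Z , Z-circuit , Z⊆S = cl Z , clZ-hyperplane , flat-absorbs⇒⊇ (cl-isFlat Z) (begin
    rank N (cl Z ∪ S) ≤⟨ rank-⊆ (∪-⊆ (cl-⊆ (⊆-trans Z⊆S ⊆cl)) ⊆cl) ⟩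
    rank N (cl S)     ≤⟨ rank-cl S ⟩
    rank N S          ≤⟨ rS≤ ⟩
    3 + k             ≡⟨ cyclicHyperplane-rank L clZ-hyperplane ⟨
    rank N (cl Z)     ∎)
    where
    open ≤-Reasoning
    clZ-nonempty : cl Z ≢ ⊥
    clZ-nonempty clZ≡⊥ with dependent⇒nonempty (proj₁ Z-circuit)
    ... | z , z∈Z = ∉⊥ (subst (z ∈_) clZ≡⊥ (⊆cl z∈Z))
    clZ-proper : cl Z ≢ ⊤
    clZ-proper clZ≡⊤ = 1+n≰n (begin
      4 + k         ≡⟨ rank-N ⟨
      rank N ⊤      ≡⟨ cong (rank N) clZ≡⊤ ⟨
      rank N (cl Z) ≤⟨ rank-cl Z ⟩
      rank N Z      ≤⟨ rank-⊆ Z⊆S ⟩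
      rank N S      ≤⟨ rS≤ ⟩
      3 + k         ∎)
    clZ-hyperplane : IsCyclicHyperplane (cl Z)
    clZ-hyperplane = cyclicFlat⇒hyperplane (cl Z)
      ((cl-isFlat Z , cl-circuit-isCyclic Z-circuit) , clZ-nonempty , clZ-proper)

  A∪B∪-spanning : IsLindstrom (4 + k) N → ∀ {x Z} → x ∉ A ∪ B → x ∈ Z → Spanning N ((A ∪ B) ∪ Z)
  A∪B∪-spanning (rank-N , _ , hyperplane⇒cyclicFlat , rAB , _) {x} {Z} x∉A∪B x∈Z = rank⊤≤⇒spanning (begin
    rank N ⊤                 ≡⟨ rank-N ⟩
    4 + k                    ≡⟨ cong suc rAB ⟨
    suc (rank N (A ∪ B))     ≤⟨ A∪B-flat x x∉A∪B ⟩
    rank N ((A ∪ B) ∪ ⁅ x ⁆) ≤⟨ rank-⊆ (∪-⊆ (p⊆p∪q Z) (⊆-trans (x∈p⇒⁅x⁆⊆p x∈Z) (q⊆p∪q (A ∪ B) Z))) ⟩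
    rank N ((A ∪ B) ∪ Z)     ∎)
    where
    open ≤-Reasoning
    A∪B-flat : IsFlat N (A ∪ B)
    A∪B-flat = proj₁ (proj₁ (hyperplane⇒cyclicFlat (A ∪ B) (inj₁ refl)))

  A∪B∪C-spanning : IsLindstrom (4 + k) N → Spanning N ((A ∪ B) ∪ C)
  A∪B∪C-spanning L = A∪B∪-spanning L (∉blockSet-∪ {m} c₀∈C (λ ()) (λ ())) c₀∈C

  A∪B∪D-spanning : IsLindstrom (4 + k) N → Spanning N ((A ∪ B) ∪ D)
  A∪B∪D-spanning L = A∪B∪-spanning L (∉blockSet-∪ {m} d₀∈D (λ ()) (λ ())) d₀∈D

  2m≤∣C∪D∣ : 2 * m ≤ ∣ C ∪ D ∣
  2m≤∣C∪D∣ = subst (_≤ ∣ C ∪ D ∣) (∣quotient⁻¹∣ m CD-blocks) (p⊆q⇒∣p∣≤∣q∣ quotient⁻¹⊆C∪D)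
    where
    CD-blocks : Subset 4
    CD-blocks = false ∷ false ∷ true ∷ true ∷ []
    quotient⁻¹⊆C∪D : tabulate (lookup CD-blocks ∘ quotient m) ⊆ C ∪ D
    quotient⁻¹⊆C∪D {x} x∈ = in-block (quotient m x) refl (∈-tabulate⁻ {g = lookup CD-blocks ∘ quotient m} x∈)
      where
      in-block : ∀ b → quotient m x ≡ b → T (lookup CD-blocks b) → x ∈ C ∪ D
      in-block zero                   _   ()
      in-block (suc zero)             _   ()
      in-block (suc (suc zero))       x∈b _ = x∈p∪q⁺ (inj₁ (∈blockSet⁺ {m} x∈b))
      in-block (suc (suc (suc zero))) x∈b _ = x∈p∪q⁺ (inj₂ (∈blockSet⁺ {m} x∈b))

  C∪D-spanning : IsLindstrom (4 + k) N → Spanning N (C ∪ D)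
  C∪D-spanning L@(rank-N , _) =
    rank⊤≤⇒spanning (≮⇒≥ λ r<r⊤ → rank-C∪D≰3+k (s≤s⁻¹ (subst (rank N (C ∪ D) <_) rank-N r<r⊤)))
    where
    open ≤-Reasoning
    4+k≤∣C∪D∣ : 4 + k ≤ ∣ C ∪ D ∣
    4+k≤∣C∪D∣ = begin
      2 + m ≤⟨ +-monoˡ-≤ m (m≤m+n 2 k) ⟩
      m + m ≡⟨ cong (m +_) (+-identityʳ m) ⟨
      2 * m ≤⟨ 2m≤∣C∪D∣ ⟩
      ∣ C ∪ D ∣ ∎
    rank-C∪D≰3+k : ¬ (rank N (C ∪ D) ≤ 3 + k)
    rank-C∪D≰3+k rCD≤ = C∪D⊈cyclicHyperplane (dependent⇒⊆cyclicHyperplane L rCD≤ λ indep →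
      <⇒≱ (s≤s rCD≤) (subst (4 + k ≤_) (sym indep) 4+k≤∣C∪D∣))

module QuasiProductProperties {k n : ℕ} (M : Matroid k) (N : Matroid n) (P : Matroid (k * n))
                              (Q : IsQuasiProduct M N P) where

  open MatroidProperties P

  rowOf : Fin (k * n) → Fin k
  rowOf p = proj₁ (pairOf {k} {n} p)

  colOf : Fin (k * n) → Fin n
  colOf p = proj₂ (pairOf {k} {n} p)

  ∈rowSet⁺ : ∀ {p} e X → rowOf p ≡ e → colOf p ∈ X → p ∈ rowSet {k} {n} e X
  ∈rowSet⁺ e X row≡e col∈X =
    ∈-tabulate⁺ {g = λ p → ⌊ rowOf p ≟ e ⌋ ∧ lookup X (colOf p)} (from T-∧ (fromWitness row≡e , ∈⇒T-lookup col∈X))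

  ∈rowSet⁻ : ∀ {p} e X → p ∈ rowSet {k} {n} e X → rowOf p ≡ e × colOf p ∈ X
  ∈rowSet⁻ e X p∈ with to T-∧ (∈-tabulate⁻ {g = λ p → ⌊ rowOf p ≟ e ⌋ ∧ lookup X (colOf p)} p∈)
  ... | row≡e , col∈X = toWitness row≡e , T-lookup⇒∈ col∈X

  ∈colSet⁺ : ∀ {p} X f → rowOf p ∈ X → colOf p ≡ f → p ∈ colSet {k} {n} X f
  ∈colSet⁺ X f row∈X col≡f =
    ∈-tabulate⁺ {g = λ p → lookup X (rowOf p) ∧ ⌊ colOf p ≟ f ⌋} (from T-∧ (∈⇒T-lookup row∈X , fromWitness col≡f))

  ∈colSet⁻ : ∀ {p} X f → p ∈ colSet {k} {n} X f → rowOf p ∈ X × colOf p ≡ f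
  ∈colSet⁻ X f p∈ with to T-∧ (∈-tabulate⁻ {g = λ p → lookup X (rowOf p) ∧ ⌊ colOf p ≟ f ⌋} p∈)
  ... | row∈X , col≡f = T-lookup⇒∈ row∈X , toWitness col≡f

  rank-rowSet⊤ : ∀ e H → Spanning N H → rank P (rowSet {k} {n} e ⊤) ≤ rank P (rowSet {k} {n} e H)
  rank-rowSet⊤ e H H-spanning with rank M ⁅ e ⁆ ℕ.≟ 0
  ... | yes e-loop = ≤-trans (≤-reflexive (proj₁ (proj₂ (proj₂ Q)) e e-loop)) z≤n
  ... | no  e-not-loop = ≤-reflexive (begin
    rank P (rowSet {k} {n} e ⊤) ≡⟨ proj₁ Q e e-not-loop ⊤ ⟩
    rank N ⊤                    ≡⟨ H-spanning ⟨
    rank N H                    ≡⟨ proj₁ Q e e-not-loop H ⟨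
    rank P (rowSet {k} {n} e H) ∎)
    where open ≡-Reasoning

  rank-colSet⊤ : ∀ W f → Spanning M W → rank P (colSet {k} {n} ⊤ f) ≤ rank P (colSet {k} {n} W f)
  rank-colSet⊤ W f W-spanning with rank N ⁅ f ⁆ ℕ.≟ 0
  ... | yes f-loop = ≤-trans (≤-reflexive (proj₂ (proj₂ (proj₂ Q)) f f-loop)) z≤n
  ... | no  f-not-loop = ≤-reflexive (begin
    rank P (colSet {k} {n} ⊤ f) ≡⟨ proj₁ (proj₂ Q) f f-not-loop ⊤ ⟩
    rank M ⊤                    ≡⟨ W-spanning ⟨
    rank M W                    ≡⟨ proj₁ (proj₂ Q) f f-not-loop W ⟨
    rank P (colSet {k} {n} W f) ∎)
    where open ≡-Reasoning

  rowSet-⊆cl : ∀ {S} e H → Spanning N H → rowSet {k} {n} e H ⊆ cl S → rowSet {k} {n} e ⊤ ⊆ cl S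
  rowSet-⊆cl e H H-spanning row⊆clS = cl-⊆ row⊆clS ∘ ⊆cl-by-rank row⊆row⊤ (rank-rowSet⊤ e H H-spanning)
    where
    row⊆row⊤ : rowSet {k} {n} e H ⊆ rowSet {k} {n} e ⊤
    row⊆row⊤ p∈ = ∈rowSet⁺ e ⊤ (proj₁ (∈rowSet⁻ e H p∈)) ∈⊤

  colSet-⊆cl : ∀ {S} W f → Spanning M W → colSet {k} {n} W f ⊆ cl S → colSet {k} {n} ⊤ f ⊆ cl S
  colSet-⊆cl W f W-spanning col⊆clS = cl-⊆ col⊆clS ∘ ⊆cl-by-rank col⊆col⊤ (rank-colSet⊤ W f W-spanning)
    where
    col⊆col⊤ : colSet {k} {n} W f ⊆ colSet {k} {n} ⊤ f
    col⊆col⊤ p∈ = ∈colSet⁺ ⊤ f ∈⊤ (proj₂ (∈colSet⁻ W f p∈))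

U23-loopless : ∀ i → ¬ IsLoop U23 i
U23-loopless zero             ()
U23-loopless (suc zero)       ()
U23-loopless (suc (suc zero)) ()

U23-pair-spanning : ∀ {i j} → i ≢ j → Spanning U23 (⁅ i ⁆ ∪ ⁅ j ⁆)
U23-pair-spanning {zero}             {zero}             i≢j = ⊥-elim (i≢j refl)
U23-pair-spanning {zero}             {suc zero}         _   = refl
U23-pair-spanning {zero}             {suc (suc zero)}   _   = refl
U23-pair-spanning {suc zero}         {zero}             _   = refl
U23-pair-spanning {suc zero}         {suc zero}         i≢j = ⊥-elim (i≢j refl)
U23-pair-spanning {suc zero}         {suc (suc zero)}   _   = refl
U23-pair-spanning {suc (suc zero)}   {zero}             _   = refl
U23-pair-spanning {suc (suc zero)}   {suc zero}         _   = refl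
U23-pair-spanning {suc (suc zero)}   {suc (suc zero)}   i≢j = ⊥-elim (i≢j refl)

module QuasiProductOfU23 {n : ℕ} (N : Matroid n) (P : Matroid (3 * n)) (Q : IsQuasiProduct U23 N P) where

  open MatroidProperties P
  open QuasiProductProperties U23 N P Q public

  rank-rowSet : ∀ i X → rank P (rowSet {3} {n} i X) ≡ rank N X
  rank-rowSet i = proj₁ Q i (U23-loopless i)

  two-rows⇒spanning : ∀ {S i j} → i ≢ j → rowSet {3} {n} i ⊤ ⊆ cl S → rowSet {3} {n} j ⊤ ⊆ cl S →
                      Spanning P S
  two-rows⇒spanning {S} {i} {j} i≢j rowᵢ⊆clS rowⱼ⊆clS = cl≡⊤⇒spanning λ p →
    colSet-⊆cl (⁅ i ⁆ ∪ ⁅ j ⁆) (colOf p) (U23-pair-spanning i≢j) column⊆clS (∈colSet⁺ ⊤ (colOf p) ∈⊤ refl)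
    where
    column⊆clS : ∀ {f} → colSet {3} {n} (⁅ i ⁆ ∪ ⁅ j ⁆) f ⊆ cl S
    column⊆clS {f} p∈ with x∈p∪q⁻ ⁅ i ⁆ ⁅ j ⁆ (proj₁ (∈colSet⁻ (⁅ i ⁆ ∪ ⁅ j ⁆) f p∈))
    ... | inj₁ row∈⁅i⁆ = rowᵢ⊆clS (∈rowSet⁺ i ⊤ (x∈⁅y⁆⇒x≡y i row∈⁅i⁆) ∈⊤)
    ... | inj₂ row∈⁅j⁆ = rowⱼ⊆clS (∈rowSet⁺ j ⊤ (x∈⁅y⁆⇒x≡y j row∈⁅j⁆) ∈⊤)

isX isY : Fin 3 → Fin 4 → Bool
isX i b = ⌊ b ≟ # 0 ⌋ ∨ (⌊ i ≟ # 0 ⌋ ∧ ⌊ b ≟ # 1 ⌋) ∨ (⌊ i ≟ # 1 ⌋ ∧ ⌊ b ≟ # 2 ⌋) ∨ (⌊ i ≟ # 2 ⌋ ∧ ⌊ b ≟ # 3 ⌋)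
isY i b = ⌊ b ≟ # 1 ⌋ ∨ (⌊ i ≟ # 0 ⌋ ∧ ⌊ b ≟ # 0 ⌋) ∨ (⌊ i ≟ # 1 ⌋ ∧ ⌊ b ≟ # 2 ⌋) ∨ (⌊ i ≟ # 2 ⌋ ∧ ⌊ b ≟ # 3 ⌋)

∈setX : ∀ {m p i b} → proj₁ (pairOf {3} {4 * m} p) ≡ i → block {m} (proj₂ (pairOf {3} {4 * m} p)) ≡ b →
        T (isX i b) → p ∈ setX m
∈setX {m} refl refl =
  ∈-tabulate⁺ {g = λ p → isX (proj₁ (pairOf {3} {4 * m} p)) (block {m} (proj₂ (pairOf {3} {4 * m} p)))}

∈setY : ∀ {m p i b} → proj₁ (pairOf {3} {4 * m} p) ≡ i → block {m} (proj₂ (pairOf {3} {4 * m} p)) ≡ b →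
        T (isY i b) → p ∈ setY m
∈setY {m} refl refl =
  ∈-tabulate⁺ {g = λ p → isY (proj₁ (pairOf {3} {4 * m} p)) (block {m} (proj₂ (pairOf {3} {4 * m} p)))}

module QuasiProductOfU23AndLindström (k : ℕ) (N : Matroid (4 * (2 + k))) (L : IsLindstrom (4 + k) N)
                                     (P : Matroid (3 * (4 * (2 + k)))) (Q : IsQuasiProduct U23 N P) where

  private
    m : ℕ
    m = 2 + k

  open MatroidProperties P
  open QuasiProductOfU23 N P Q
  open Lindström k N

  X Y R₀ : Subset (3 * (4 * m))
  X = setX m
  Y = setY m
  R₀ = rowSet {3} {4 * m} (# 0) ⊤

  ∈X : ∀ {p} i b → rowOf p ≡ i → colOf p ∈ blockSet m b → T (isX i b) → p ∈ X
  ∈X i b row≡i col∈b = ∈setX {m} row≡i (∈blockSet⁻ {m} col∈b)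

  ∈Y : ∀ {p} i b → rowOf p ≡ i → colOf p ∈ blockSet m b → T (isY i b) → p ∈ Y
  ∈Y i b row≡i col∈b = ∈setY {m} row≡i (∈blockSet⁻ {m} col∈b)

  ∈X∩Y : ∀ {p} i b → rowOf p ≡ i → colOf p ∈ blockSet m b → T (isX i b) → T (isY i b) → p ∈ X ∩ Y
  ∈X∩Y i b row≡i col∈b inX inY = x∈p∩q⁺ {p = X} {q = Y} (∈X i b row≡i col∈b inX , ∈Y i b row≡i col∈b inY)

  A∪B-columns⊆X∪Y : ∀ {p} → colOf p ∈ A ∪ B → p ∈ X ∪ Y
  A∪B-columns⊆X∪Y {p} col∈A∪B with x∈p∪q⁻ A B col∈A∪B
  ... | inj₁ col∈A = p⊆p∪q Y (∈X (rowOf p) (# 0) refl col∈A _)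
  ... | inj₂ col∈B = q⊆p∪q X Y (∈Y (rowOf p) (# 1) refl col∈B _)

  X∪Y-spanning : Spanning P (X ∪ Y)
  X∪Y-spanning = two-rows⇒spanning {i = # 1} {# 2} (λ ())
    (rowSet-⊆cl (# 1) ((A ∪ B) ∪ C) (A∪B∪C-spanning L) (⊆cl ∘ row₁⊆X∪Y))
    (rowSet-⊆cl (# 2) ((A ∪ B) ∪ D) (A∪B∪D-spanning L) (⊆cl ∘ row₂⊆X∪Y))
    where
    row₁⊆X∪Y : rowSet {3} {4 * m} (# 1) ((A ∪ B) ∪ C) ⊆ X ∪ Y
    row₁⊆X∪Y p∈ with ∈rowSet⁻ (# 1) ((A ∪ B) ∪ C) p∈
    ... | row≡1 , col∈ with x∈p∪q⁻ (A ∪ B) C col∈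
    ... | inj₁ col∈A∪B = A∪B-columns⊆X∪Y col∈A∪B
    ... | inj₂ col∈C   = p⊆p∪q Y (∈X (# 1) (# 2) row≡1 col∈C _)
    row₂⊆X∪Y : rowSet {3} {4 * m} (# 2) ((A ∪ B) ∪ D) ⊆ X ∪ Y
    row₂⊆X∪Y p∈ with ∈rowSet⁻ (# 2) ((A ∪ B) ∪ D) p∈
    ... | row≡2 , col∈ with x∈p∪q⁻ (A ∪ B) D col∈
    ... | inj₁ col∈A∪B = A∪B-columns⊆X∪Y col∈A∪B
    ... | inj₂ col∈D   = p⊆p∪q Y (∈X (# 2) (# 3) row≡2 col∈D _)

  X∩Y∪R₀-spanning : Spanning P ((X ∩ Y) ∪ R₀)
  X∩Y∪R₀-spanning = two-rows⇒spanning {i = # 0} {# 2} (λ ())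
    (⊆cl ∘ q⊆p∪q (X ∩ Y) R₀)
    (rowSet-⊆cl (# 2) (C ∪ D) (C∪D-spanning L) row₂⊆cl)
    where
    column⊆X∩Y∪R₀ : ∀ {f} → f ∈ C → colSet {3} {4 * m} (⁅ # 0 ⁆ ∪ ⁅ # 1 ⁆) f ⊆ (X ∩ Y) ∪ R₀
    column⊆X∩Y∪R₀ {f} f∈C p∈ with ∈colSet⁻ (⁅ # 0 ⁆ ∪ ⁅ # 1 ⁆) f p∈
    ... | row∈ , col≡f with x∈p∪q⁻ ⁅ # 0 ⁆ ⁅ # 1 ⁆ row∈
    ... | inj₁ row∈⁅0⁆ = q⊆p∪q (X ∩ Y) R₀ (∈rowSet⁺ (# 0) ⊤ (x∈⁅y⁆⇒x≡y (# 0) row∈⁅0⁆) ∈⊤)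
    ... | inj₂ row∈⁅1⁆ = p⊆p∪q R₀ (∈X∩Y (# 1) (# 2) (x∈⁅y⁆⇒x≡y (# 1) row∈⁅1⁆) (subst (_∈ C) (sym col≡f) f∈C) _ _)
    row₂⊆cl : rowSet {3} {4 * m} (# 2) (C ∪ D) ⊆ cl ((X ∩ Y) ∪ R₀)
    row₂⊆cl {p} p∈ = [ through-column , (λ col∈D → ⊆cl (p⊆p∪q R₀ (∈X∩Y (# 2) (# 3) row≡2 col∈D _ _))) ]′
                       (x∈p∪q⁻ C D col∈C∪D)
      where
      row≡2 : rowOf p ≡ # 2
      row≡2 = proj₁ (∈rowSet⁻ (# 2) (C ∪ D) p∈)
      col∈C∪D : colOf p ∈ C ∪ D
      col∈C∪D = proj₂ (∈rowSet⁻ (# 2) (C ∪ D) p∈)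
      through-column : colOf p ∈ C → p ∈ cl ((X ∩ Y) ∪ R₀)
      through-column col∈C =
        colSet-⊆cl (⁅ # 0 ⁆ ∪ ⁅ # 1 ⁆) (colOf p) (U23-pair-spanning {# 0} {# 1} (λ ()))
                   (⊆cl ∘ column⊆X∩Y∪R₀ col∈C) (∈colSet⁺ ⊤ (colOf p) ∈⊤ refl)

  rank⊤≤1+rank-X∩Y : rank P ⊤ ≤ suc (rank P (X ∩ Y))
  rank⊤≤1+rank-X∩Y = +-cancelʳ-≤ (3 + k) (rank P ⊤) (suc (rank P (X ∩ Y))) (begin
    rank P ⊤ + (3 + k)               ≡⟨ cong (rank P ⊤ +_) rank-R₀[A∪B] ⟨
    rank P ⊤ + rank P R₀[A∪B]        ≤⟨ +-monoʳ-≤ (rank P ⊤) (rank-⊆ R₀[A∪B]⊆) ⟩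
    rank P ⊤ + rank P ((X ∩ Y) ∩ R₀) ≤⟨ spanning-∪⇒submodular X∩Y∪R₀-spanning ⟩
    rank P (X ∩ Y) + rank P R₀       ≡⟨ cong (rank P (X ∩ Y) +_) rank-R₀ ⟩
    rank P (X ∩ Y) + (4 + k)         ≡⟨ +-suc (rank P (X ∩ Y)) (3 + k) ⟩
    suc (rank P (X ∩ Y)) + (3 + k)   ∎)
    where
    open ≤-Reasoning
    R₀[A∪B] : Subset (3 * (4 * m))
    R₀[A∪B] = rowSet {3} {4 * m} (# 0) (A ∪ B)
    rank-R₀ : rank P R₀ ≡ 4 + k
    rank-R₀ = trans (rank-rowSet (# 0) ⊤) (proj₁ L)
    rank-R₀[A∪B] : rank P R₀[A∪B] ≡ 3 + k
    rank-R₀[A∪B] = trans (rank-rowSet (# 0) (A ∪ B)) (cyclicHyperplane-rank L (inj₁ refl))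
    R₀[A∪B]⊆ : R₀[A∪B] ⊆ (X ∩ Y) ∩ R₀
    R₀[A∪B]⊆ p∈ with ∈rowSet⁻ (# 0) (A ∪ B) p∈
    ... | row≡0 , col∈ with x∈p∪q⁻ A B col∈
    ... | inj₁ col∈A = x∈p∩q⁺ {p = X ∩ Y} {q = R₀} (∈X∩Y (# 0) (# 0) row≡0 col∈A _ _ , ∈rowSet⁺ (# 0) ⊤ row≡0 ∈⊤)
    ... | inj₂ col∈B = x∈p∩q⁺ {p = X ∩ Y} {q = R₀} (∈X∩Y (# 0) (# 1) row≡0 col∈B _ _ , ∈rowSet⁺ (# 0) ⊤ row≡0 ∈⊤)

mainTheorem8 : (r : ℕ) → 4 ≤ r → (N : Matroid (4 * (r ∸ 2))) → IsLindstrom r N →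
    (P : Matroid (3 * (4 * (r ∸ 2)))) → IsQuasiProduct U23 N P →
    Spanning P (setX (r ∸ 2)) ⊎ Spanning P (setY (r ∸ 2))
mainTheorem8 0 ()
mainTheorem8 1 (s≤s ())
mainTheorem8 2 (s≤s (s≤s ()))
mainTheorem8 3 (s≤s (s≤s (s≤s ())))
mainTheorem8 (suc (suc (suc (suc k)))) _ N L P Q = spanning-∪⇒spanning-⊎ X∪Y-spanning rank⊤≤1+rank-X∩Y
  where
  open MatroidProperties P
  open QuasiProductOfU23AndLindström k N L P Q
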